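{- Let $L=\left(\frac{1-x}{1+x^2},\frac{x}{1+x^2}\right)^{ -1}$ and $\mathbb{B}=L\cdot(1+x,x)^t$. Then $$\mathbb{B}=\left(\frac{1-x^2}{1+x^2},\frac{x}{1+x^2}\right)^{ -1}\cdot(1+x,x)\cdot(1+x,x)^t.$$
   Context: A Riordan array $(g,f)$, where $g(x)=1+g_1x+\cdots$ and $f(x)=x+f_2x^2+\cdots$ are formal power series, is the infinite lower-triangular matrix (rows and columns indexed from $0$) whose $k$-th column has ordinary generating function $g(x)f(x)^k$; Riordan arrays form a group under matrix multiplication with $(g,f)(h,l)=(g\,(h\circ f),l\circ f)$, identity $(1,x)$, and $(g,f)^{ -1}=(1/(g\circ\bar f),\bar f)$, $\bar f$ the compositional inverse of $f$. $M^t$ denotes the transpose; $(1+x,x)$ is the lower-triangular matrix with $1$ on the main diagonal and first subdiagonal, and $(1+x,x)^t$ its transpose. -}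

module Defs where

open import Data.Nat using (ℕ; zero; suc; _∸_; _≡ᵇ_)
open import Data.Integer using (ℤ; +_; -_; _+_; _*_; 0ℤ; 1ℤ)
open import Data.List using (List; []; _∷_; _++_)
open import Data.Bool using (if_then_else_)

-- Formal power series over ℤ: coefficient sequences.
Series : Set
Series = ℕ → ℤ

-- Infinite matrices over ℤ, rows and columns indexed from 0.
Matrix : Set
Matrix = ℕ → ℕ → ℤ

sumTo : ℕ → (ℕ → ℤ) → ℤ
sumTo zero    f = 0ℤ
sumTo (suc n) f = sumTo n f + f n

-- n-th element of a list, 0 if out of range
nth : List ℤ → ℕ → ℤ
nth []       _       = 0ℤ
nth (x ∷ xs) zero    = x
nth (x ∷ xs) (suc n) = nth xs n

-- polynomial with given coefficient list (constant term first)
poly : List ℤ → Series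
poly = nth

δ : ℕ → ℕ → ℤ
δ i j = if i ≡ᵇ j then 1ℤ else 0ℤ

_⊛_ : Series → Series → Series
(a ⊛ b) n = sumTo (suc n) (λ i → a i * b (n ∸ i))

oneS : Series
oneS = δ 0

_^ˢ_ : Series → ℕ → Series
f ^ˢ zero  = oneS
f ^ˢ suc k = f ⊛ (f ^ˢ k)

build : (ℕ → List ℤ → ℤ) → ℕ → List ℤ
build step zero    = []
build step (suc n) = let prev = build step n in prev ++ (step n prev ∷ [])

cov : (ℕ → List ℤ → ℤ) → ℕ → ℤ
cov step i = nth (build step (suc i)) i

-- multiplicative inverse 1/a of a series with constant term a 0 = 1:
-- h n = [n = 0] - Σ_{1 ≤ i ≤ n} a i h (n - i)
recip : Series → Series
recip a = cov (λ n prev → δ n 0 + - sumTo n (λ i → a (suc i) * nth prev (n ∸ suc i)))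

-- Riordan array (g , f): column k has generating function g f^k
riordan : Series → Series → Matrix
riordan g f n k = (g ⊛ (f ^ˢ k)) n

-- product A · B of matrices when A is lower triangular (then the sum over
-- the inner index is exactly the finite sum over k ≤ i)
_·_ : Matrix → Matrix → Matrix
(A · B) i j = sumTo (suc i) (λ k → A i k * B k j)

infixl 7 _·_

_ᵗ : Matrix → Matrix
(M ᵗ) i j = M j i

-- matrix inverse of a lower-triangular matrix with 1's on the diagonal
-- (all Riordan arrays (g,f) with g(0)=1, f'(0)=1 are such), computed by
-- forward substitution column by column:
-- N i j = δ i j - Σ_{k < i} M i k N k j
inv : Matrix → Matrix
inv M i j = cov (λ n prev → δ n j + - sumTo n (λ k → M n k * nth prev k)) i

xS : Series
xS = poly (0ℤ ∷ 1ℤ ∷ [])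

onePlusX : Series
onePlusX = poly (1ℤ ∷ 1ℤ ∷ [])

oneMinusX : Series
oneMinusX = poly (1ℤ ∷ - 1ℤ ∷ [])

onePlusX² : Series
onePlusX² = poly (1ℤ ∷ 0ℤ ∷ 1ℤ ∷ [])

oneMinusX² : Series
oneMinusX² = poly (1ℤ ∷ 0ℤ ∷ - 1ℤ ∷ [])

fS : Series
fS = xS ⊛ recip onePlusX²

L : Matrix
L = inv (riordan (oneMinusX ⊛ recip onePlusX²) fS)

P : Matrix
P = riordan onePlusX xS

𝔹 : Matrix
𝔹 = L · (P ᵗ)

-- Write A = ((1-x)/(1+x²), x/(1+x²)), C = ((1-x²)/(1+x²), x/(1+x²)) and
-- P = (1+x, x), so that L = A⁻¹ and 𝔹 = A⁻¹ · Pᵗ.  Since 1-x² = (1+x)(1-x),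
-- the fundamental theorem of Riordan arrays gives C = P · A, hence
-- C⁻¹ · P = A⁻¹ · P⁻¹ · P = A⁻¹; multiplying on the right by Pᵗ gives the
-- theorem.
module Submission where

open import Defs
open import Relation.Binary.PropositionalEquality
  using (_≡_; _≢_; refl; sym; trans; cong; cong₂; subst; module ≡-Reasoning)
open import Data.Nat using (ℕ; zero; suc; _<_; _≤_; _∸_; _≡ᵇ_; s≤s)
open import Data.Nat.Properties
  using (≤-refl; m<n⇒m<1+n; m<1+n⇒m<n∨m≡n; m∸n≤m; ≤-<-trans; <-≤-trans;
         <-trans; <⇒≢; >⇒≢; ≮⇒≥; _<?_; ≡ᵇ⇒≡)
open import Data.Nat.Induction using (<-rec)
open import Data.Integer using (ℤ; -_; _+_; _*_; 0ℤ; 1ℤ; -1ℤ)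
open import Data.Integer.Properties
  using (+-identityʳ; +-identityˡ; +-assoc; *-zeroˡ; *-zeroʳ; *-identityˡ;
         *-identityʳ; *-distribˡ-+; *-distribʳ-+; -1*i≡-i)
open import Data.Integer.Solver using (module +-*-Solver)
open import Data.List using (List; []; _∷_; _++_; length)
open import Data.Bool using (true; false; T)
open import Data.Unit using (tt)
open import Data.Sum using (inj₁; inj₂)
open import Data.Product using (_×_; _,_; proj₁; proj₂)
open import Data.Empty using (⊥-elim)
open import Relation.Nullary using (yes; no)
open +-*-Solver using (solve; _:+_; :-_; _:=_)
open ≡-Reasoning

_≗ˢ_ : Series → Series → Set
a ≗ˢ b = ∀ n → a n ≡ b n

infix 4 _≗ˢ_

sumTo-cong : ∀ n {f g : ℕ → ℤ} → (∀ k → k < n → f k ≡ g k) → sumTo n f ≡ sumTo n g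
sumTo-cong zero    eq = refl
sumTo-cong (suc n) eq = cong₂ _+_ (sumTo-cong n (λ k k<n → eq k (m<n⇒m<1+n k<n))) (eq n ≤-refl)

sumTo-zero : ∀ n {f : ℕ → ℤ} → (∀ k → k < n → f k ≡ 0ℤ) → sumTo n f ≡ 0ℤ
sumTo-zero zero    eq = refl
sumTo-zero (suc n) eq = cong₂ _+_ (sumTo-zero n (λ k k<n → eq k (m<n⇒m<1+n k<n))) (eq n ≤-refl)

sumTo-+ : ∀ n (f g : ℕ → ℤ) → sumTo n (λ k → f k + g k) ≡ sumTo n f + sumTo n g
sumTo-+ zero    f g = refl
sumTo-+ (suc n) f g = trans (cong (_+ (f n + g n)) (sumTo-+ n f g))
  (solve 4 (λ a b c d → (a :+ b) :+ (c :+ d) := (a :+ c) :+ (b :+ d)) refl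
     (sumTo n f) (sumTo n g) (f n) (g n))

sumTo-first : ∀ n (f : ℕ → ℤ) → sumTo (suc n) f ≡ f 0 + sumTo n (λ k → f (suc k))
sumTo-first zero    f = trans (+-identityˡ (f 0)) (sym (+-identityʳ (f 0)))
sumTo-first (suc n) f = trans (cong (_+ f (suc n)) (sumTo-first n f)) (+-assoc (f 0) _ _)

δ-diag : ∀ i → δ i i ≡ 1ℤ
δ-diag zero    = refl
δ-diag (suc i) = δ-diag i

δ-off : ∀ {i j} → i ≢ j → δ i j ≡ 0ℤ
δ-off {i} {j} i≢j with i ≡ᵇ j in eq
... | true  = ⊥-elim (i≢j (≡ᵇ⇒≡ i j (subst T (sym eq) tt)))
... | false = refl

sumTo-δ-out : ∀ n (F : ℕ → ℤ) j → n ≤ j → sumTo n (λ m → F m * δ m j) ≡ 0ℤ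
sumTo-δ-out n F j n≤j = sumTo-zero n (λ m m<n →
  trans (cong (F m *_) (δ-off (<⇒≢ (<-≤-trans m<n n≤j)))) (*-zeroʳ (F m)))

sumTo-δ-in : ∀ n (F : ℕ → ℤ) j → j < n → sumTo n (λ m → F m * δ m j) ≡ F j
sumTo-δ-in (suc n) F j j<1+n with m<1+n⇒m<n∨m≡n j<1+n
... | inj₁ j<n = begin
  sumTo n (λ m → F m * δ m j) + F n * δ n j ≡⟨ cong₂ _+_ (sumTo-δ-in n F j j<n) (cong (F n *_) (δ-off (>⇒≢ j<n))) ⟩
  F j + F n * 0ℤ                            ≡⟨ cong (F j +_) (*-zeroʳ (F n)) ⟩
  F j + 0ℤ                                  ≡⟨ +-identityʳ (F j) ⟩
  F j                                       ∎
... | inj₂ refl = begin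
  sumTo n (λ m → F m * δ m n) + F n * δ n n ≡⟨ cong₂ _+_ (sumTo-δ-out n F n ≤-refl) (cong (F n *_) (δ-diag n)) ⟩
  0ℤ + F n * 1ℤ                             ≡⟨ +-identityˡ _ ⟩
  F n * 1ℤ                                  ≡⟨ *-identityʳ (F n) ⟩
  F n                                       ∎

sumTo-δ : ∀ n (F : ℕ → ℤ) j → (n ≤ j → F j ≡ 0ℤ) → sumTo n (λ m → F m * δ m j) ≡ F j
sumTo-δ n F j out with j <? n
... | yes j<n = sumTo-δ-in n F j j<n
... | no  j≮n = trans (sumTo-δ-out n F j (≮⇒≥ j≮n)) (sym (out (≮⇒≥ j≮n)))

build-length : ∀ s n → length (build s n) ≡ n
build-length s zero    = refl
build-length s (suc n) = trans (length-snoc (build s n)) (cong suc (build-length s n))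
  where
  length-snoc : ∀ (xs : List ℤ) {y} → length (xs ++ y ∷ []) ≡ suc (length xs)
  length-snoc []       = refl
  length-snoc (x ∷ xs) = cong suc (length-snoc xs)

nth-++ˡ : ∀ (xs ys : List ℤ) k → k < length xs → nth (xs ++ ys) k ≡ nth xs k
nth-++ˡ (x ∷ xs) ys zero    _         = refl
nth-++ˡ (x ∷ xs) ys (suc k) (s≤s k<n) = nth-++ˡ xs ys k k<n

nth-last : ∀ (xs : List ℤ) y → nth (xs ++ y ∷ []) (length xs) ≡ y
nth-last []       y = refl
nth-last (x ∷ xs) y = nth-last xs y

build-nth : ∀ s n k → k < n → nth (build s n) k ≡ cov s k
build-nth s (suc n) k k<1+n with m<1+n⇒m<n∨m≡n k<1+n
... | inj₁ k<n  = trans (nth-++ˡ (build s n) _ k (subst (k <_) (sym (build-length s n)) k<n))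
                        (build-nth s n k k<n)
... | inj₂ refl = refl

cov-unfold : ∀ s n → cov s n ≡ s n (build s n)
cov-unfold s n = subst (λ m → nth (build s n ++ s n (build s n) ∷ []) m ≡ s n (build s n))
                       (build-length s n) (nth-last (build s n) _)

UnitDiagonal : Matrix → Set
UnitDiagonal M = ∀ i → M i i ≡ 1ℤ

LowerTriangular : Matrix → Set
LowerTriangular M = ∀ i j → i < j → M i j ≡ 0ℤ

IsRightInverse : Matrix → Matrix → Set
IsRightInverse M X = ∀ i j → (M · X) i j ≡ δ i j

SolvesForward : Matrix → Matrix → Set
SolvesForward M X = ∀ i j → X i j ≡ δ i j + - sumTo i (λ k → M i k * X k j)

inv-forward : ∀ M → SolvesForward M (inv M)
inv-forward M i j = trans (cov-unfold _ i) (cong (λ z → δ i j + - z)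
  (sumTo-cong i (λ k k<i → cong (M i k *_) (build-nth _ i k k<i))))

forward-unique : ∀ M X Y → SolvesForward M X → SolvesForward M Y → ∀ i j → X i j ≡ Y i j
forward-unique M X Y solX solY = <-rec (λ i → ∀ j → X i j ≡ Y i j) step
  where
  step : ∀ i → (∀ {k} → k < i → ∀ j → X k j ≡ Y k j) → ∀ j → X i j ≡ Y i j
  step i ih j = begin
    X i j                                        ≡⟨ solX i j ⟩
    δ i j + - sumTo i (λ k → M i k * X k j)      ≡⟨ cong (λ z → δ i j + - z)
                                                      (sumTo-cong i (λ k k<i → cong (M i k *_) (ih k<i j))) ⟩
    δ i j + - sumTo i (λ k → M i k * Y k j)      ≡⟨ solY i j ⟨
    Y i j                                        ∎

unitDiagonal-row : ∀ M X → UnitDiagonal M → ∀ i j →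
  (M · X) i j ≡ sumTo i (λ k → M i k * X k j) + X i j
unitDiagonal-row M X diag i j = cong (λ z → sumTo i (λ k → M i k * X k j) + z)
  (trans (cong (_* X i j) (diag i)) (*-identityˡ (X i j)))

inv-rightInverse : ∀ M → UnitDiagonal M → IsRightInverse M (inv M)
inv-rightInverse M diag i j = begin
  (M · inv M) i j           ≡⟨ unitDiagonal-row M (inv M) diag i j ⟩
  S + inv M i j             ≡⟨ cong (S +_) (inv-forward M i j) ⟩
  S + (δ i j + - S)         ≡⟨ solve 2 (λ s d → s :+ (d :+ :- s) := d) refl S (δ i j) ⟩
  δ i j                     ∎
  where S = sumTo i (λ k → M i k * inv M k j)

inv-unique : ∀ M X → UnitDiagonal M → IsRightInverse M X → ∀ i j → X i j ≡ inv M i j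
inv-unique M X diag MX=I = forward-unique M X (inv M) solX (inv-forward M)
  where
  solX : SolvesForward M X
  solX i j = begin
    X i j              ≡⟨ solve 2 (λ s x → x := (s :+ x) :+ :- s) refl S (X i j) ⟩
    S + X i j + - S    ≡⟨ cong (_+ - S) (sym (unitDiagonal-row M X diag i j)) ⟩
    (M · X) i j + - S  ≡⟨ cong (_+ - S) (MX=I i j) ⟩
    δ i j + - S        ∎
    where S = sumTo i (λ k → M i k * X k j)

inv-lower : ∀ M → LowerTriangular (inv M)
inv-lower M = <-rec (λ i → ∀ j → i < j → inv M i j ≡ 0ℤ) step
  where
  step : ∀ i → (∀ {k} → k < i → ∀ j → k < j → inv M k j ≡ 0ℤ) → ∀ j → i < j → inv M i j ≡ 0ℤ
  step i ih j i<j = trans (inv-forward M i j)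
    (cong₂ (λ a b → a + - b) (δ-off (<⇒≢ i<j))
      (sumTo-zero i (λ k k<i → trans (cong (M i k *_) (ih k<i j (<-trans k<i i<j))) (*-zeroʳ (M i k)))))

shiftS : Series → Series
shiftS s zero    = 0ℤ
shiftS s (suc n) = s n

shift-cong : ∀ {a b} → a ≗ˢ b → shiftS a ≗ˢ shiftS b
shift-cong eq zero    = refl
shift-cong eq (suc n) = eq n

shift-scale : ∀ c s n → shiftS (λ m → c * s m) n ≡ c * shiftS s n
shift-scale c s zero    = sym (*-zeroʳ c)
shift-scale c s (suc n) = refl

⊛-congˡ : ∀ {a b} → a ≗ˢ b → ∀ F → a ⊛ F ≗ˢ b ⊛ F
⊛-congˡ eq F n = sumTo-cong (suc n) (λ i _ → cong (_* F (n ∸ i)) (eq i))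

⊛-distribʳ : ∀ a b F n → ((λ m → a m + b m) ⊛ F) n ≡ (a ⊛ F) n + (b ⊛ F) n
⊛-distribʳ a b F n = trans (sumTo-cong (suc n) (λ i _ → *-distribʳ-+ (F (n ∸ i)) (a i) (b i)))
  (sumTo-+ (suc n) (λ i → a i * F (n ∸ i)) (λ i → b i * F (n ∸ i)))

-- g = g 0 + x · g', where g' i = g (i + 1).
⊛-head : ∀ g F n → (g ⊛ F) n ≡ g 0 * F n + shiftS ((λ i → g (suc i)) ⊛ F) n
⊛-head g F zero    = trans (+-identityˡ (g 0 * F 0)) (sym (+-identityʳ (g 0 * F 0)))
⊛-head g F (suc n) = sumTo-first (suc n) _

shift-⊛ : ∀ g F n → (shiftS g ⊛ F) n ≡ shiftS (g ⊛ F) n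
shift-⊛ g F n = trans (⊛-head (shiftS g) F n)
  (trans (cong (_+ shiftS (g ⊛ F) n) (*-zeroˡ (F n))) (+-identityˡ (shiftS (g ⊛ F) n)))

constant-⊛ : ∀ c F n → (poly (c ∷ []) ⊛ F) n ≡ c * F n
constant-⊛ c F n = trans (⊛-head (poly (c ∷ [])) F n) (trans (cong (c * F n +_) (zero-tail n)) (+-identityʳ _))
  where
  zero-tail : ∀ n → shiftS (poly [] ⊛ F) n ≡ 0ℤ
  zero-tail zero    = refl
  zero-tail (suc n) = sumTo-zero (suc n) (λ i _ → *-zeroˡ (F (n ∸ i)))

linear-⊛ : ∀ c d F n → (poly (c ∷ d ∷ []) ⊛ F) n ≡ c * F n + d * shiftS F n
linear-⊛ c d F n = trans (⊛-head (poly (c ∷ d ∷ [])) F n)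
  (cong (c * F n +_) (trans (shift-cong (constant-⊛ d F) n) (shift-scale d F n)))

xS-⊛ : ∀ F → xS ⊛ F ≗ˢ shiftS F
xS-⊛ F n = trans (linear-⊛ 0ℤ 1ℤ F n)
  (trans (cong₂ _+_ (*-zeroˡ (F n)) (*-identityˡ (shiftS F n))) (+-identityˡ _))

onePlusX-⊛ : ∀ F → onePlusX ⊛ F ≗ˢ (λ n → F n + shiftS F n)
onePlusX-⊛ F n = trans (linear-⊛ 1ℤ 1ℤ F n) (cong₂ _+_ (*-identityˡ (F n)) (*-identityˡ (shiftS F n)))

oneMinusX-⊛ : ∀ F → oneMinusX ⊛ F ≗ˢ (λ n → F n + - shiftS F n)
oneMinusX-⊛ F n = trans (linear-⊛ 1ℤ -1ℤ F n) (cong₂ _+_ (*-identityˡ (F n)) (-1*i≡-i (shiftS F n)))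

oneMinusX²-⊛ : ∀ F → oneMinusX² ⊛ F ≗ˢ (λ n → F n + - shiftS (shiftS F) n)
oneMinusX²-⊛ F n = begin
  (oneMinusX² ⊛ F) n                                 ≡⟨ ⊛-head oneMinusX² F n ⟩
  1ℤ * F n + shiftS (poly (0ℤ ∷ -1ℤ ∷ []) ⊛ F) n      ≡⟨ cong₂ _+_ (*-identityˡ (F n)) (shift-cong minusX-⊛ n) ⟩
  F n + shiftS (λ m → -1ℤ * shiftS F m) n            ≡⟨ cong (F n +_) (shift-scale -1ℤ (shiftS F) n) ⟩
  F n + -1ℤ * shiftS (shiftS F) n                    ≡⟨ cong (F n +_) (-1*i≡-i _) ⟩
  F n + - shiftS (shiftS F) n                        ∎
  where
  minusX-⊛ : poly (0ℤ ∷ -1ℤ ∷ []) ⊛ F ≗ˢ (λ m → -1ℤ * shiftS F m)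
  minusX-⊛ m = trans (linear-⊛ 0ℤ -1ℤ F m) (trans (cong (_+ -1ℤ * shiftS F m) (*-zeroˡ (F m))) (+-identityˡ _))

-- 1 - x² = (1 + x)(1 - x), tested against any series F.
oneMinusX²-factor : ∀ F → oneMinusX² ⊛ F ≗ˢ onePlusX ⊛ (oneMinusX ⊛ F)
oneMinusX²-factor F n = begin
  (oneMinusX² ⊛ F) n                     ≡⟨ oneMinusX²-⊛ F n ⟩
  F n + - F₂ n                           ≡⟨ solve 3 (λ a b c → a :+ :- c := (a :+ :- b) :+ (b :+ :- c)) refl (F n) (F₁ n) (F₂ n) ⟩
  (F n + - F₁ n) + (F₁ n + - F₂ n)       ≡⟨ cong₂ _+_ (sym (oneMinusX-⊛ F n)) (sym (shift-oneMinusX n)) ⟩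
  G n + shiftS G n                       ≡⟨ onePlusX-⊛ G n ⟨
  (onePlusX ⊛ G) n                       ∎
  where
  F₁ F₂ G : Series
  F₁ = shiftS F
  F₂ = shiftS F₁
  G  = oneMinusX ⊛ F
  shift-oneMinusX : ∀ n → shiftS G n ≡ F₁ n + - F₂ n
  shift-oneMinusX zero    = refl
  shift-oneMinusX (suc n) = oneMinusX-⊛ F n

shift-δ : ∀ j → shiftS (λ m → δ m j) ≗ˢ (λ n → δ n (suc j))
shift-δ j zero    = refl
shift-δ j (suc n) = refl

xS-pow : ∀ j → xS ^ˢ j ≗ˢ (λ n → δ n j)
xS-pow zero    zero    = refl
xS-pow zero    (suc n) = refl
xS-pow (suc j) n       = trans (xS-⊛ (xS ^ˢ j) n) (trans (shift-cong (xS-pow j) n) (shift-δ j n))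

P-entry : ∀ n j → P n j ≡ δ n j + δ n (suc j)
P-entry n j = trans (onePlusX-⊛ (xS ^ˢ j) n)
  (cong₂ _+_ (xS-pow j n) (trans (shift-cong (xS-pow j) n) (shift-δ j n)))

·P-entry : ∀ N → LowerTriangular N → ∀ k j → (N · P) k j ≡ N k j + N k (suc j)
·P-entry N lowN k j = begin
  (N · P) k j
    ≡⟨ sumTo-cong (suc k) (λ m _ → trans (cong (N k m *_) (P-entry m j)) (*-distribˡ-+ (N k m) (δ m j) (δ m (suc j)))) ⟩
  sumTo (suc k) (λ m → N k m * δ m j + N k m * δ m (suc j))
    ≡⟨ sumTo-+ (suc k) _ _ ⟩
  sumTo (suc k) (λ m → N k m * δ m j) + sumTo (suc k) (λ m → N k m * δ m (suc j))
    ≡⟨ cong₂ _+_ (sumTo-δ (suc k) (N k) j (lowN k j)) (sumTo-δ (suc k) (N k) (suc j) (lowN k (suc j))) ⟩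
  N k j + N k (suc j)
    ∎

StartsAt : ℕ → Series → Set
StartsAt k F = (∀ n → n < k → F n ≡ 0ℤ) × F k ≡ 1ℤ

⊛-vanishes : ∀ k F → (∀ n → n < k → F n ≡ 0ℤ) → ∀ g n → n < k → (g ⊛ F) n ≡ 0ℤ
⊛-vanishes k F low g n n<k = sumTo-zero (suc n) (λ i _ →
  trans (cong (g i *_) (low (n ∸ i) (≤-<-trans (m∸n≤m n i) n<k))) (*-zeroʳ (g i)))

startsAt-⊛ : ∀ {k F} g → g 0 ≡ 1ℤ → StartsAt k F → StartsAt k (g ⊛ F)
startsAt-⊛ {k} {F} g g0 (low , lead) = ⊛-vanishes k F low g , (begin
  (g ⊛ F) k                                         ≡⟨ ⊛-head g F k ⟩
  g 0 * F k + shiftS ((λ i → g (suc i)) ⊛ F) k      ≡⟨ cong₂ _+_ (cong₂ _*_ g0 lead) (tail-vanishes k low) ⟩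
  1ℤ                                                ∎)
  where
  tail-vanishes : ∀ m → (∀ n → n < m → F n ≡ 0ℤ) → shiftS ((λ i → g (suc i)) ⊛ F) m ≡ 0ℤ
  tail-vanishes zero    _    = refl
  tail-vanishes (suc m) lowᵐ = ⊛-vanishes (suc m) F lowᵐ (λ i → g (suc i)) m ≤-refl

startsAt-shift : ∀ {k F} → StartsAt k F → StartsAt (suc k) (shiftS F)
startsAt-shift {k} {F} (low , lead) = low′ , lead
  where
  low′ : ∀ n → n < suc k → shiftS F n ≡ 0ℤ
  low′ zero    _         = refl
  low′ (suc n) (s≤s n<k) = low n n<k

startsAt-cong : ∀ {k F G} → F ≗ˢ G → StartsAt k F → StartsAt k G
startsAt-cong {k} F=G (low , lead) = (λ n n<k → trans (sym (F=G n)) (low n n<k)) , trans (sym (F=G k)) lead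

startsAt-pow : ∀ h → h 0 ≡ 1ℤ → ∀ k → StartsAt k ((xS ⊛ h) ^ˢ k)
startsAt-pow h h0 zero    = (λ n ()) , refl
startsAt-pow h h0 (suc k) = startsAt-cong (λ n → sym (times-xh n))
                              (startsAt-shift (startsAt-⊛ h h0 (startsAt-pow h h0 k)))
  where
  F : Series
  F = (xS ⊛ h) ^ˢ k
  times-xh : ∀ n → ((xS ⊛ h) ⊛ F) n ≡ shiftS (h ⊛ F) n
  times-xh n = trans (⊛-congˡ (xS-⊛ h) F n) (shift-⊛ h F n)

riordan-column : ∀ g h → g 0 ≡ 1ℤ → h 0 ≡ 1ℤ → ∀ k → StartsAt k (λ n → riordan g (xS ⊛ h) n k)
riordan-column g h g0 h0 k = startsAt-⊛ g g0 (startsAt-pow h h0 k)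

riordan-lower : ∀ g h → g 0 ≡ 1ℤ → h 0 ≡ 1ℤ → LowerTriangular (riordan g (xS ⊛ h))
riordan-lower g h g0 h0 n k = proj₁ (riordan-column g h g0 h0 k) n

riordan-diag : ∀ g h → g 0 ≡ 1ℤ → h 0 ≡ 1ℤ → UnitDiagonal (riordan g (xS ⊛ h))
riordan-diag g h g0 h0 k = proj₂ (riordan-column g h g0 h0 k)

-- C = P · A, row by row: row n of C is row n plus row n-1 of A.
IsPTimes : Matrix → Matrix → Set
IsPTimes C A = ∀ n k → C n k ≡ A n k + shiftS (λ m → A m k) n

riordan-onePlusX : ∀ g g′ → g′ ≗ˢ onePlusX ⊛ g → ∀ f → IsPTimes (riordan g′ f) (riordan g f)
riordan-onePlusX g g′ g′=[1+x]g f n k = begin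
  (g′ ⊛ F) n                          ≡⟨ ⊛-congˡ (λ m → trans (g′=[1+x]g m) (onePlusX-⊛ g m)) F n ⟩
  ((λ m → g m + shiftS g m) ⊛ F) n    ≡⟨ ⊛-distribʳ g (shiftS g) F n ⟩
  (g ⊛ F) n + (shiftS g ⊛ F) n        ≡⟨ cong ((g ⊛ F) n +_) (shift-⊛ g F n) ⟩
  (g ⊛ F) n + shiftS (g ⊛ F) n        ∎
  where
  F : Series
  F = f ^ˢ k

PTimes-· : ∀ C A N → IsPTimes C A → LowerTriangular A → IsPTimes (C · N) (A · N)
PTimes-· C A N C=PA lowA n k = begin
  (C · N) n k
    ≡⟨ sumTo-cong (suc n) (λ m _ → trans (cong (_* N m k) (C=PA n m)) (*-distribʳ-+ (N m k) (A n m) (shiftS (λ r → A r m) n))) ⟩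
  sumTo (suc n) (λ m → A n m * N m k + shiftS (λ r → A r m) n * N m k)
    ≡⟨ sumTo-+ (suc n) _ _ ⟩
  (A · N) n k + sumTo (suc n) (λ m → shiftS (λ r → A r m) n * N m k)
    ≡⟨ cong ((A · N) n k +_) (previous-row n) ⟩
  (A · N) n k + shiftS (λ r → (A · N) r k) n
    ∎
  where
  -- row n-1 of A has no entry in column n, so its product with N is a sum up to n-1
  previous-row : ∀ n → sumTo (suc n) (λ m → shiftS (λ r → A r m) n * N m k) ≡ shiftS (λ r → (A · N) r k) n
  previous-row zero    = sumTo-zero 1 (λ m _ → *-zeroˡ (N m k))
  previous-row (suc n) = trans (cong ((A · N) n k +_) (trans (cong (_* N (suc n) k) (lowA n (suc n) ≤-refl)) (*-zeroˡ (N (suc n) k))))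
                               (+-identityʳ ((A · N) n k))

-- A left inverse of P is also a right inverse: if P · Y = I then
-- (Y · P) i j = Y i j + Y i (j+1) = δ i j.
P-inverse-sides : ∀ Y → IsPTimes δ Y → ∀ i j → Y i j + Y i (suc j) ≡ δ i j
P-inverse-sides Y PY=I zero j = begin
  Y 0 j + Y 0 (suc j)                 ≡⟨ cong₂ _+_ (sym (+-identityʳ (Y 0 j))) (sym (+-identityʳ (Y 0 (suc j)))) ⟩
  (Y 0 j + 0ℤ) + (Y 0 (suc j) + 0ℤ)   ≡⟨ cong₂ _+_ (sym (PY=I 0 j)) (sym (PY=I 0 (suc j))) ⟩
  δ 0 j + 0ℤ                          ≡⟨ +-identityʳ (δ 0 j) ⟩
  δ 0 j                               ∎
P-inverse-sides Y PY=I (suc i) j = begin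
  a + b
    ≡⟨ solve 4 (λ a b c d → a :+ b := ((a :+ c) :+ (b :+ d)) :+ :- (c :+ d)) refl a b (Y i j) (Y i (suc j)) ⟩
  ((a + Y i j) + (b + Y i (suc j))) + - (Y i j + Y i (suc j))
    ≡⟨ cong₂ (λ u v → u + - v) (cong₂ _+_ (sym (PY=I (suc i) j)) (sym (PY=I (suc i) (suc j))))
                               (P-inverse-sides Y PY=I i j) ⟩
  (δ (suc i) j + δ i j) + - δ i j
    ≡⟨ solve 2 (λ d e → (d :+ e) :+ :- e := d) refl (δ (suc i) j) (δ i j) ⟩
  δ (suc i) j
    ∎
  where
  a b : ℤ
  a = Y (suc i) j
  b = Y (suc i) (suc j)

inv-PTimes : ∀ C A → UnitDiagonal A → LowerTriangular A → IsPTimes C A → ∀ i j → (inv C · P) i j ≡ inv A i j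
inv-PTimes C A diagA lowA C=PA = inv-unique A (N · P) diagA A[NP]=I
  where
  diagC : UnitDiagonal C
  diagC zero    = trans (C=PA 0 0) (trans (+-identityʳ _) (diagA 0))
  diagC (suc i) = trans (C=PA (suc i) (suc i)) (cong₂ _+_ (diagA (suc i)) (lowA i (suc i) ≤-refl))

  N : Matrix
  N = inv C

  -- Y = A · N satisfies P · Y = C · N = I.
  PY=I : IsPTimes δ (A · N)
  PY=I n k = trans (sym (inv-rightInverse C diagC n k)) (PTimes-· C A N C=PA lowA n k)

  A[NP]=I : IsRightInverse A (N · P)
  A[NP]=I i j = begin
    (A · (N · P)) i j
      ≡⟨ sumTo-cong (suc i) (λ k _ → trans (cong (A i k *_) (·P-entry N (inv-lower C) k j)) (*-distribˡ-+ (A i k) (N k j) (N k (suc j)))) ⟩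
    sumTo (suc i) (λ k → A i k * N k j + A i k * N k (suc j))
      ≡⟨ sumTo-+ (suc i) _ _ ⟩
    (A · N) i j + (A · N) i (suc j)
      ≡⟨ P-inverse-sides (A · N) PY=I i j ⟩
    δ i j
      ∎

mainTheorem4 : ∀ i j → 𝔹 i j ≡ (inv (riordan (oneMinusX² ⊛ recip onePlusX²) fS) · P · (P ᵗ)) i j
mainTheorem4 i j = sumTo-cong (suc i) (λ k _ → cong (_* P j k) (sym (C⁻¹P=A⁻¹ i k)))
  where
  r gA gC : Series
  r  = recip onePlusX²
  gA = oneMinusX ⊛ r
  gC = oneMinusX² ⊛ r

  -- C = P · A, because 1 - x² = (1 + x)(1 - x)
  C=PA : IsPTimes (riordan gC fS) (riordan gA fS)
  C=PA = riordan-onePlusX gA gC (oneMinusX²-factor r) fS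

  C⁻¹P=A⁻¹ : ∀ i k → (inv (riordan gC fS) · P) i k ≡ L i k
  C⁻¹P=A⁻¹ = inv-PTimes (riordan gC fS) (riordan gA fS)
               (riordan-diag gA r refl refl) (riordan-lower gA r refl refl) C=PA
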